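{- Let $\pi,\sigma,\delta,\rho$ be permutations and $l\le k$ positive integers such that $\delta\lessdot_l\pi$, $\rho\lessdot_l\sigma$, $\delta\lessdot_k\rho$ and $\pi\lessdot_k\sigma$. If $\delta\ne\mathrm{id}$, suppose furthermore that $l\le d_1(\delta)$ and $k\ge d_2(\delta)$. Then (a) $k\ge d_2(\pi)$ and $l\le d_1(\pi)$; (b) $l\le d_1(\rho)$ and $k\ge d_2(\rho)$.
   Context: Permutations are in one-line notation, $\ell$ is Coxeter length, and $t_{ab}$ is the transposition of $a,b$ ($\pi t_{ab}$ swaps the entries of $\pi$ in positions $a$ and $b$). We write $\rho\lessdot_k\pi$ if $\pi=\rho t_{ab}$ for some $a\le k<b$ and $\ell(\pi)=\ell(\rho)+1$. A descent of $\pi$ is an $i$ with $\pi(i)>\pi(i+1)$; for $\pi\ne\mathrm{id}$, $d_1(\pi)$ and $d_2(\pi)$ denote the first (smallest) and last (largest) descent positions. -}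

module Defs where

open import Data.Nat using (ℕ; zero; suc; _+_; _≤_; _<_)
open import Data.Fin using (Fin; toℕ)
import Data.Fin as F
open import Data.Fin.Permutation using (Permutation′; _⟨$⟩ʳ_; _≈_; _∘ₚ_; transpose; id)
open import Data.List using (List; map; allFin)
open import Data.Nat.ListAction using (sum)
open import Data.Product using (Σ; ∃; _×_)
open import Relation.Nullary using (¬_; Dec; yes; no)
open import Relation.Binary.PropositionalEquality using (_≡_)

-- Permutations of {1,…,n} in one-line notation: position i (1-indexed)
-- corresponds to the Fin index with toℕ = i - 1, and π(i) is π ⟨$⟩ʳ i.

𝟙 : {P : Set} → Dec P → ℕ
𝟙 (yes _) = 1
𝟙 (no _)  = 0

len : {n : ℕ} → Permutation′ n → ℕ
len {n} π = sum (map (λ i → sum (map (λ j →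
  𝟙 (i F.<? j) * 𝟙 ((π ⟨$⟩ʳ j) F.<? (π ⟨$⟩ʳ i))) (allFin n))) (allFin n))
  where open Data.Nat using (_*_)

-- ρ ⋖[ k ] π :  π = ρ t_ab for some positions a ≤ k < b (1-indexed),
-- and ℓ(π) = ℓ(ρ) + 1.  (ρ t_ab)(i) = ρ(t_ab(i)), i.e. transpose a b ∘ₚ ρ.
_⋖[_]_ : {n : ℕ} → Permutation′ n → ℕ → Permutation′ n → Set
_⋖[_]_ {n} ρ k π = Σ (Fin n) λ a → Σ (Fin n) λ b →
  (suc (toℕ a) ≤ k) × (k < suc (toℕ b)) ×
  (π ≈ (transpose a b ∘ₚ ρ)) × (len π ≡ suc (len ρ))

-- d is a descent (1-indexed) of π: π(d) > π(d+1)
IsDescent : {n : ℕ} → Permutation′ n → ℕ → Set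
IsDescent {n} π d = Σ (Fin n) λ i → Σ (Fin n) λ j →
  (suc (toℕ i) ≡ d) × (toℕ j ≡ d) × ((π ⟨$⟩ʳ j) F.< (π ⟨$⟩ʳ i))

IsFirstDescent : {n : ℕ} → Permutation′ n → ℕ → Set
IsFirstDescent π d = IsDescent π d × (∀ e → IsDescent π e → d ≤ e)

IsLastDescent : {n : ℕ} → Permutation′ n → ℕ → Set
IsLastDescent π d = IsDescent π d × (∀ e → IsDescent π e → e ≤ d)

IsId : {n : ℕ} → Permutation′ n → Set
IsId π = π ≈ id

-- Let a < b and ρ(a) < ρ(b).  Sending each inversion (i, j) of ρ to (t_ab i, t_ab j), except
-- when one of i, j is a or b and the other lies strictly between them (then it stays put),
-- injects the inversions of ρ into those of ρ t_ab and misses (a, b), and also (c, b) whenever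
-- a < c < b and ρ(a) < ρ(c) < ρ(b).  Hence if ρ ⋖ ρ t_ab, then ρ(a) < ρ(b) (otherwise
-- ρ = (ρ t_ab) t_ab would be longer than ρ t_ab) and there is no such c.  So every descent of
-- ρ t_ab is a descent of ρ, except a descent at a when b = a + 1, and for ρ ⋖_m ρ t_ab that one
-- is m.  A cover ⋖_m with l ≤ m ≤ k therefore keeps all descents inside [l, k]; apply this to
-- δ ⋖_l π and to δ ⋖_k ρ.
module Submission where

open import Defs
open import Data.Bool using (Bool; true; false; if_then_else_)
open import Data.Bool.Properties using (if-eta)
open import Data.Empty using (⊥-elim)
open import Data.Fin as F using (Fin; toℕ)
import Data.Fin.Properties as FP
open import Data.Fin.Permutation using (Permutation′; _⟨$⟩ʳ_; _≈_; _∘ₚ_; transpose)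
import Data.Fin.Permutation.Components as PC
open import Data.List using (map; allFin; tabulate)
import Data.Nat.ListAction as List
open import Data.Nat using (ℕ; zero; suc; _+_; _*_; _≤_; _<_; z≤n; s≤s; s≤s⁻¹)
open import Data.Nat.Induction using (<-rec)
import Data.Nat.Properties as NP
open import Data.Product using (∃; _,_; proj₁; proj₂; _×_; swap)
open import Data.Sum using (_⊎_; inj₁; inj₂; map₂)
open import Function using (_∘_; mk⇔)
open import Function.Bundles using (Injection)
open import Function.Properties.Inverse using (↔⇒↣)
open import Level using (0ℓ)
open import Relation.Binary.Definitions using (tri<; tri≈; tri>)
open import Relation.Binary.PropositionalEquality
open import Relation.Nullary using (¬_; Dec; yes; no; does)
open import Relation.Nullary.Decidable using (_×-dec_; _⊎-dec_; dec-true; dec-false; does-⇔)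
open import Relation.Unary using (Pred; Decidable)
open import Algebra.Properties.CommutativeMonoid.Sum NP.+-0-commutativeMonoid
  using (sum; sum-cong-≗; ∑-distrib-+; ∑-permute)

IsLeast IsGreatest : Pred ℕ 0ℓ → ℕ → Set
IsLeast P d = P d × (∀ e → P e → d ≤ e)
IsGreatest P d = P d × (∀ e → P e → e ≤ d)

module _ {P : Pred ℕ 0ℓ} (P? : Decidable P) where

  least : ∀ {e} → P e → ∃ (IsLeast P)
  least {e} = <-rec (λ e → P e → ∃ (IsLeast P)) step e
    where
    step : ∀ e → (∀ {e′} → e′ < e → P e′ → ∃ (IsLeast P)) → P e → ∃ (IsLeast P)
    step e rec Pe with NP.anyUpTo? P? e
    ... | yes (d , d<e , Pd) = rec d<e Pd
    ... | no none = e , Pe , λ e′ Pe′ → NP.≮⇒≥ λ e′<e → none (e′ , e′<e , Pe′)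

  greatest : ∀ v → (∀ e → P e → e < v) → ∀ {e} → P e → ∃ (IsGreatest P)
  greatest zero    bounded Pe = ⊥-elim (NP.n≮0 (bounded _ Pe))
  greatest (suc v) bounded Pe with P? v
  ... | yes Pv = v , Pv , λ e Pe′ → s≤s⁻¹ (bounded e Pe′)
  ... | no ¬Pv = greatest v (λ e Pe′ → NP.≤∧≢⇒< (s≤s⁻¹ (bounded e Pe′)) λ { refl → ¬Pv Pe′ }) Pe

sum-map-tabulate : ∀ {n} {A : Set} (f : A → ℕ) (g : Fin n → A) →
                   List.sum (map f (tabulate g)) ≡ sum (f ∘ g)
sum-map-tabulate {zero}  f g = refl
sum-map-tabulate {suc n} f g = cong (f (g F.zero) +_) (sum-map-tabulate f (g ∘ F.suc))

sum-mono-≤ : ∀ {n} {f g : Fin n → ℕ} → (∀ i → f i ≤ g i) → sum f ≤ sum g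
sum-mono-≤ {zero}  f≤g = z≤n
sum-mono-≤ {suc n} f≤g = NP.+-mono-≤ (f≤g F.zero) (sum-mono-≤ (f≤g ∘ F.suc))

sum-mono-< : ∀ {n} {f g : Fin n → ℕ} → (∀ i → f i ≤ g i) → ∀ u → f u < g u → sum f < sum g
sum-mono-< f≤g F.zero    fu<gu = NP.+-mono-<-≤ fu<gu (sum-mono-≤ (f≤g ∘ F.suc))
sum-mono-< f≤g (F.suc u) fu<gu = NP.+-mono-≤-< (f≤g F.zero) (sum-mono-< (f≤g ∘ F.suc) u fu<gu)

m<n⇒o<p⇒2+m+o≤n+p : ∀ {m n o p} → m < n → o < p → 2 + (m + o) ≤ n + p
m<n⇒o<p⇒2+m+o≤n+p {m} {n} {o} {p} m<n o<p =
  subst (_≤ n + p) (cong suc (NP.+-suc m o)) (NP.+-mono-≤ m<n o<p)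

sum-mono-<₂ : ∀ {n} {f g : Fin n → ℕ} → (∀ i → f i ≤ g i) → ∀ {u v} → u ≢ v →
              f u < g u → f v < g v → 2 + sum f ≤ sum g
sum-mono-<₂ f≤g {F.zero}  {F.zero}  u≢v _ _ = ⊥-elim (u≢v refl)
sum-mono-<₂ f≤g {F.zero}  {F.suc v} _ fu<gu fv<gv =
  m<n⇒o<p⇒2+m+o≤n+p fu<gu (sum-mono-< (f≤g ∘ F.suc) v fv<gv)
sum-mono-<₂ f≤g {F.suc u} {F.zero}  _ fu<gu fv<gv =
  m<n⇒o<p⇒2+m+o≤n+p fv<gv (sum-mono-< (f≤g ∘ F.suc) u fu<gu)
sum-mono-<₂ {f = f} {g} f≤g {F.suc u} {F.suc v} u≢v fu<gu fv<gv =
  subst (_≤ sum g) (trans (NP.+-suc (f F.zero) _) (cong suc (NP.+-suc (f F.zero) _)))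
    (NP.+-mono-≤ (f≤g F.zero) (sum-mono-<₂ (f≤g ∘ F.suc) (u≢v ∘ cong F.suc) fu<gu fv<gv))

Σ² : ∀ {n} → (Fin n → Fin n → ℕ) → ℕ
Σ² F = sum λ i → sum (F i)

module _ {n : ℕ} where

  Σ²-cong : {F G : Fin n → Fin n → ℕ} → (∀ i j → F i j ≡ G i j) → Σ² F ≡ Σ² G
  Σ²-cong F≡G = sum-cong-≗ λ i → sum-cong-≗ (F≡G i)

  Σ²-distrib-+ : (F G : Fin n → Fin n → ℕ) → Σ² (λ i j → F i j + G i j) ≡ Σ² F + Σ² G
  Σ²-distrib-+ F G = trans (sum-cong-≗ λ i → ∑-distrib-+ (F i) (G i))
                           (∑-distrib-+ (λ i → sum (F i)) (λ i → sum (G i)))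

  Σ²-permute : (p : Permutation′ n) (F : Fin n → Fin n → ℕ) →
               Σ² F ≡ Σ² (λ i j → F (p ⟨$⟩ʳ i) (p ⟨$⟩ʳ j))
  Σ²-permute p F = trans (∑-permute _ p) (sum-cong-≗ λ i → ∑-permute (F (p ⟨$⟩ʳ i)) p)

  Σ²-permute-off : (p : Permutation′ n) (r : Fin n → Fin n → Bool) →
                   (∀ i j → r (p ⟨$⟩ʳ i) (p ⟨$⟩ʳ j) ≡ r i j) → (F : Fin n → Fin n → ℕ) →
                   Σ² F ≡ Σ² (λ i j → if r i j then F i j else F (p ⟨$⟩ʳ i) (p ⟨$⟩ʳ j))
  Σ²-permute-off p r r-invariant F = begin
    Σ² F                                           ≡⟨ Σ²-cong unsplit ⟩
    Σ² (λ i j → on i j + off F i j)                ≡⟨ Σ²-distrib-+ on (off F) ⟩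
    Σ² on + Σ² (off F)                             ≡⟨ cong (Σ² on +_) (Σ²-permute p (off F)) ⟩
    Σ² on + Σ² (λ i j → off F (p ⟨$⟩ʳ i) (p ⟨$⟩ʳ j)) ≡⟨ cong (Σ² on +_) (Σ²-cong off-permute) ⟩
    Σ² on + Σ² (off Fp)                            ≡⟨ Σ²-distrib-+ on (off Fp) ⟨
    Σ² (λ i j → on i j + off Fp i j)               ≡⟨ Σ²-cong split ⟨
    Σ² (λ i j → if r i j then F i j else Fp i j)   ∎
    where
    open ≡-Reasoning
    Fp : Fin n → Fin n → ℕ
    Fp i j = F (p ⟨$⟩ʳ i) (p ⟨$⟩ʳ j)
    on : Fin n → Fin n → ℕ
    on i j = if r i j then F i j else 0
    off : (Fin n → Fin n → ℕ) → Fin n → Fin n → ℕ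
    off H i j = if r i j then 0 else H i j
    split : ∀ {H} i j → (if r i j then F i j else H i j) ≡ on i j + off H i j
    split i j with r i j
    ... | true  = sym (NP.+-identityʳ _)
    ... | false = refl
    unsplit : ∀ i j → F i j ≡ on i j + off F i j
    unsplit i j = trans (sym (if-eta (r i j))) (split {F} i j)
    off-permute : ∀ i j → off F (p ⟨$⟩ʳ i) (p ⟨$⟩ʳ j) ≡ off Fp i j
    off-permute i j rewrite r-invariant i j = refl

  Σ²-mono-< : {F G : Fin n → Fin n → ℕ} → (∀ i j → F i j ≤ G i j) →
              ∀ u v → F u v < G u v → Σ² F < Σ² G
  Σ²-mono-< F≤G u v lt =
    sum-mono-< (λ i → sum-mono-≤ (F≤G i)) u (sum-mono-< (F≤G u) v lt)

  Σ²-mono-<₂ : {F G : Fin n → Fin n → ℕ} → (∀ i j → F i j ≤ G i j) →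
               ∀ {u u′} v v′ → u ≢ u′ → F u v < G u v → F u′ v′ < G u′ v′ → 2 + Σ² F ≤ Σ² G
  Σ²-mono-<₂ F≤G v v′ u≢u′ lt lt′ =
    sum-mono-<₂ (λ i → sum-mono-≤ (F≤G i)) u≢u′
      (sum-mono-< (F≤G _) v lt) (sum-mono-< (F≤G _) v′ lt′)

module _ {A B : Set} where

  𝟙-mono : (A? : Dec A) (B? : Dec B) → (A → B) → 𝟙 A? ≤ 𝟙 B?
  𝟙-mono (yes _) (yes _)  _   = NP.≤-refl
  𝟙-mono (yes a) (no ¬b)  A⇒B = ⊥-elim (¬b (A⇒B a))
  𝟙-mono (no _)  _        _   = z≤n

  𝟙-< : (A? : Dec A) (B? : Dec B) → ¬ A → B → 𝟙 A? < 𝟙 B?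
  𝟙-< (yes a) _       ¬a _ = ⊥-elim (¬a a)
  𝟙-< (no _)  (yes _) _  _ = s≤s z≤n
  𝟙-< (no _)  (no ¬b) _  b = ⊥-elim (¬b b)

  𝟙-* : (A? : Dec A) (B? : Dec B) → 𝟙 A? * 𝟙 B? ≡ 𝟙 (A? ×-dec B?)
  𝟙-* (yes _) (yes _) = refl
  𝟙-* (yes _) (no _)  = refl
  𝟙-* (no _)  (yes _) = refl
  𝟙-* (no _)  (no _)  = refl

if-does-elim : ∀ {A B : Set} (P : B → Set) (A? : Dec A) {u v : B} →
               (A → P u) → (¬ A → P v) → P (if does A? then u else v)
if-does-elim P (yes a) Pu _  = Pu a
if-does-elim P (no ¬a) _  Pv = Pv ¬a

permutation-injective : ∀ {n} (x : Permutation′ n) {i j} → x ⟨$⟩ʳ i ≡ x ⟨$⟩ʳ j → i ≡ j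
permutation-injective x = Injection.injective (↔⇒↣ x)

Inversion : ∀ {n} → Permutation′ n → Fin n → Fin n → Set
Inversion x i j = i F.< j × x ⟨$⟩ʳ j F.< x ⟨$⟩ʳ i

inversion? : ∀ {n} (x : Permutation′ n) i j → Dec (Inversion x i j)
inversion? x i j = (i F.<? j) ×-dec (x ⟨$⟩ʳ j F.<? x ⟨$⟩ʳ i)

inversions : ∀ {n} → Permutation′ n → Fin n → Fin n → ℕ
inversions x i j = 𝟙 (inversion? x i j)

len≡Σ²-inversions : ∀ {n} (x : Permutation′ n) → len x ≡ Σ² (inversions x)
len≡Σ²-inversions {n} x = trans (sum-map-tabulate row (λ i → i)) (sum-cong-≗ λ i →
  trans (sum-map-tabulate (entry i) (λ j → j))
        (sum-cong-≗ λ j → 𝟙-* (i F.<? j) (x ⟨$⟩ʳ j F.<? x ⟨$⟩ʳ i)))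
  where
  entry : Fin n → Fin n → ℕ
  entry i j = 𝟙 (i F.<? j) * 𝟙 (x ⟨$⟩ʳ j F.<? x ⟨$⟩ʳ i)
  row : Fin n → ℕ
  row i = List.sum (map (entry i) (allFin n))

len-cong : ∀ {n} {x y : Permutation′ n} → x ≈ y → len x ≡ len y
len-cong {x = x} {y} x≈y = begin
  len x              ≡⟨ len≡Σ²-inversions x ⟩
  Σ² (inversions x)  ≡⟨ Σ²-cong (λ i j → cong₂ (λ u v → 𝟙 ((i F.<? j) ×-dec (u F.<? v)))
                                              (x≈y j) (x≈y i)) ⟩
  Σ² (inversions y)  ≡⟨ len≡Σ²-inversions y ⟨
  len y              ∎
  where open ≡-Reasoning

module Transposition {n : ℕ} (a b : Fin n) where

  t : Fin n → Fin n
  t = PC.transpose a b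

  t-a : t a ≡ b
  t-a rewrite dec-true (a F.≟ a) refl = refl

  t-b : t b ≡ a
  t-b with b F.≟ a
  ... | yes b≡a = b≡a
  ... | no b≢a rewrite dec-true (b F.≟ b) refl = refl

  t-fix : ∀ {i} → i ≢ a → i ≢ b → t i ≡ i
  t-fix {i} i≢a i≢b rewrite dec-false (i F.≟ a) i≢a | dec-false (i F.≟ b) i≢b = refl

  data View : Fin n → Set where
    at-a      : View a
    at-b      : View b
    elsewhere : ∀ {i} → i ≢ a → i ≢ b → View i

  view : ∀ i → View i
  view i with i F.≟ a | i F.≟ b
  ... | yes refl | _        = at-a
  ... | no _     | yes refl = at-b
  ... | no i≢a   | no i≢b   = elsewhere i≢a i≢b

  t-involutive : ∀ i → t (t i) ≡ i
  t-involutive i with view i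
  ... | at-a              = trans (cong t t-a) t-b
  ... | at-b              = trans (cong t t-b) t-a
  ... | elsewhere i≢a i≢b = trans (cong t (t-fix i≢a i≢b)) (t-fix i≢a i≢b)

module _ {n : ℕ} (x : Permutation′ n) {a b : Fin n} (a<b : a F.< b)
         (xa<xb : x ⟨$⟩ʳ a F.< x ⟨$⟩ʳ b) where

  open Transposition a b

  private
    y : Permutation′ n
    y = transpose a b ∘ₚ x

    IsEnd Inside : Fin n → Set
    IsEnd i = i ≡ a ⊎ i ≡ b
    Inside i = a F.< i × i F.< b

    Straddles : Fin n → Fin n → Set
    Straddles i j = (IsEnd i × Inside j) ⊎ (Inside i × IsEnd j)

    straddles? : ∀ i j → Dec (Straddles i j)
    straddles? i j = (isEnd? i ×-dec inside? j) ⊎-dec (inside? i ×-dec isEnd? j)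
      where
      isEnd? : ∀ i → Dec (IsEnd i)
      isEnd? i = (i F.≟ a) ⊎-dec (i F.≟ b)
      inside? : ∀ i → Dec (Inside i)
      inside? i = (a F.<? i) ×-dec (i F.<? b)

    t-inside : ∀ {i} → Inside i → t i ≡ i
    t-inside (a<i , i<b) = t-fix (FP.<⇒≢ a<i ∘ sym) (FP.<⇒≢ i<b)

    t-isEnd : ∀ {i} → IsEnd i → IsEnd (t i)
    t-isEnd (inj₁ refl) = inj₂ t-a
    t-isEnd (inj₂ refl) = inj₁ t-b

    t-straddles : ∀ {i j} → Straddles i j → Straddles (t i) (t j)
    t-straddles (inj₁ (end , ins)) = inj₁ (t-isEnd end , subst Inside (sym (t-inside ins)) ins)
    t-straddles (inj₂ (ins , end)) = inj₂ (subst Inside (sym (t-inside ins)) ins , t-isEnd end)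

    straddles-invariant : ∀ i j → does (straddles? (t i) (t j)) ≡ does (straddles? i j)
    straddles-invariant i j =
      does-⇔ (mk⇔ untranspose t-straddles) (straddles? (t i) (t j)) (straddles? i j)
      where
      untranspose : Straddles (t i) (t j) → Straddles i j
      untranspose s = subst₂ Straddles (t-involutive i) (t-involutive j) (t-straddles s)

    inversion-straddling : ∀ {i j} → Straddles i j → Inversion x i j → Inversion y i j
    inversion-straddling (inj₁ (inj₁ refl , ins)) (i<j , xj<xa) rewrite t-a | t-inside ins =
      i<j , FP.<-trans xj<xa xa<xb
    inversion-straddling (inj₁ (inj₂ refl , (_ , j<b))) (b<j , _) = ⊥-elim (FP.<-asym j<b b<j)
    inversion-straddling (inj₂ ((a<i , _) , inj₁ refl)) (i<a , _) = ⊥-elim (FP.<-asym a<i i<a)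
    inversion-straddling (inj₂ (ins , inj₂ refl)) (i<b , xb<xi) rewrite t-b | t-inside ins =
      i<b , FP.<-trans xa<xb xb<xi

    ordered-off-straddles : ∀ {i j} → ¬ Straddles i j →
                            t i F.< t j → x ⟨$⟩ʳ t j F.< x ⟨$⟩ʳ t i → i F.< j
    ordered-off-straddles {i} {j} ¬s ti<tj xtj<xti with view i | view j
    ... | at-a | at-a = ⊥-elim (FP.<-irrefl refl ti<tj)
    ... | at-a | at-b rewrite t-a | t-b = ⊥-elim (FP.<-asym a<b ti<tj)
    ... | at-a | elsewhere j≢a j≢b rewrite t-a | t-fix j≢a j≢b = FP.<-trans a<b ti<tj
    ... | at-b | at-a rewrite t-a | t-b = ⊥-elim (FP.<-asym xa<xb xtj<xti)
    ... | at-b | at-b = ⊥-elim (FP.<-irrefl refl ti<tj)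
    ... | at-b | elsewhere j≢a j≢b rewrite t-b | t-fix j≢a j≢b with FP.<-cmp j b
    ...   | tri< j<b _ _ = ⊥-elim (¬s (inj₁ (inj₂ refl , (ti<tj , j<b))))
    ...   | tri≈ _ j≡b _ = ⊥-elim (j≢b j≡b)
    ...   | tri> _ _ b<j = b<j
    ordered-off-straddles {i} {j} ¬s ti<tj xtj<xti | elsewhere i≢a i≢b | at-a
      rewrite t-a | t-fix i≢a i≢b with FP.<-cmp i a
    ...   | tri< i<a _ _ = i<a
    ...   | tri≈ _ i≡a _ = ⊥-elim (i≢a i≡a)
    ...   | tri> _ _ a<i = ⊥-elim (¬s (inj₂ ((a<i , ti<tj) , inj₁ refl)))
    ordered-off-straddles {i} {j} ¬s ti<tj xtj<xti | elsewhere i≢a i≢b | at-b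
      rewrite t-b | t-fix i≢a i≢b = FP.<-trans ti<tj a<b
    ordered-off-straddles {i} {j} ¬s ti<tj xtj<xti | elsewhere i≢a i≢b | elsewhere j≢a j≢b
      rewrite t-fix i≢a i≢b | t-fix j≢a j≢b = ti<tj

    inversion-off-straddles : ∀ {i j} → ¬ Straddles i j → Inversion x (t i) (t j) → Inversion y i j
    inversion-off-straddles ¬s (ti<tj , xtj<xti) = ordered-off-straddles ¬s ti<tj xtj<xti , xtj<xti

    moved : Fin n → Fin n → ℕ
    moved i j = if does (straddles? i j) then inversions x i j else inversions x (t i) (t j)

    len≡Σ²-moved : len x ≡ Σ² moved
    len≡Σ²-moved = trans (len≡Σ²-inversions x)
      (Σ²-permute-off (transpose a b) (λ i j → does (straddles? i j)) straddles-invariant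
                      (inversions x))

    moved≤inversions : ∀ i j → moved i j ≤ inversions y i j
    moved≤inversions i j = if-does-elim (_≤ inversions y i j) (straddles? i j)
      (λ s  → 𝟙-mono (inversion? x i j) (inversion? y i j) (inversion-straddling s))
      (λ ¬s → 𝟙-mono (inversion? x (t i) (t j)) (inversion? y i j) (inversion-off-straddles ¬s))

    moved<inversions : ∀ {i j} → ¬ Inversion x i j → ¬ Inversion x (t i) (t j) → Inversion y i j →
                   moved i j < inversions y i j
    moved<inversions {i} {j} ¬inv ¬invt inv = if-does-elim (_< inversions y i j) (straddles? i j)
      (λ _ → 𝟙-< (inversion? x i j) (inversion? y i j) ¬inv inv)
      (λ _ → 𝟙-< (inversion? x (t i) (t j)) (inversion? y i j) ¬invt inv)

    moved<inversions-ab : moved a b < inversions y a b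
    moved<inversions-ab = moved<inversions (λ (_ , xb<xa) → FP.<-asym xa<xb xb<xa) ¬inversion-ba inversion-ab
      where
      ¬inversion-ba : ¬ Inversion x (t a) (t b)
      ¬inversion-ba rewrite t-a | t-b = λ (b<a , _) → FP.<-asym a<b b<a
      inversion-ab : Inversion y a b
      inversion-ab rewrite t-a | t-b = a<b , xa<xb

  len-transpose-< : len x < len (transpose a b ∘ₚ x)
  len-transpose-< = subst₂ _<_ (sym len≡Σ²-moved) (sym (len≡Σ²-inversions y))
                      (Σ²-mono-< moved≤inversions a b moved<inversions-ab)

  len-transpose-between : ∀ {c} → a F.< c → c F.< b →
                          x ⟨$⟩ʳ a F.< x ⟨$⟩ʳ c → x ⟨$⟩ʳ c F.< x ⟨$⟩ʳ b →
                          2 + len x ≤ len (transpose a b ∘ₚ x)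
  len-transpose-between {c} a<c c<b xa<xc xc<xb =
    subst₂ (λ u v → 2 + u ≤ v) (sym len≡Σ²-moved) (sym (len≡Σ²-inversions y))
      (Σ²-mono-<₂ moved≤inversions b b (FP.<⇒≢ a<c) moved<inversions-ab moved<inversions-cb)
    where
    tc≡c : t c ≡ c
    tc≡c = t-fix (FP.<⇒≢ a<c ∘ sym) (FP.<⇒≢ c<b)
    ¬inversion-ca : ¬ Inversion x (t c) (t b)
    ¬inversion-ca rewrite tc≡c | t-b = λ (c<a , _) → FP.<-asym a<c c<a
    inversion-cb : Inversion y c b
    inversion-cb rewrite tc≡c | t-b = c<b , xa<xc
    moved<inversions-cb : moved c b < inversions y c b
    moved<inversions-cb = moved<inversions (λ (_ , xb<xc) → FP.<-asym xc<xb xb<xc) ¬inversion-ca inversion-cb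

module _ {n : ℕ} (δ : Permutation′ n) {a b : Fin n} (a<b : a F.< b)
         (cover : len (transpose a b ∘ₚ δ) ≡ suc (len δ)) where

  open Transposition a b

  cover-increasing : δ ⟨$⟩ʳ a F.< δ ⟨$⟩ʳ b
  cover-increasing with FP.<-cmp (δ ⟨$⟩ʳ a) (δ ⟨$⟩ʳ b)
  ... | tri< δa<δb _ _ = δa<δb
  ... | tri≈ _ δa≡δb _ = ⊥-elim (FP.<⇒≢ a<b (permutation-injective δ δa≡δb))
  ... | tri> _ _ δb<δa = ⊥-elim (NP.<-asym (NP.n<1+n (len δ)) (subst (_< len δ) cover shorter))
    where
    δt : Permutation′ n
    δt = transpose a b ∘ₚ δ
    shorter : len δt < len δ
    shorter = subst (len δt <_)
      (len-cong {x = transpose a b ∘ₚ δt} {δ} (λ i → cong (δ ⟨$⟩ʳ_) (t-involutive i)))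
      (len-transpose-< δt a<b (subst₂ (λ u v → δ ⟨$⟩ʳ u F.< δ ⟨$⟩ʳ v) (sym t-a) (sym t-b) δb<δa))

  cover-gap : ∀ {c} → a F.< c → c F.< b → δ ⟨$⟩ʳ a F.< δ ⟨$⟩ʳ c → ¬ δ ⟨$⟩ʳ c F.< δ ⟨$⟩ʳ b
  cover-gap a<c c<b δa<δc δc<δb = NP.1+n≰n (s≤s⁻¹ (subst (2 + len δ ≤_) cover
    (len-transpose-between δ a<b cover-increasing a<c c<b δa<δc δc<δb)))

module _ {n : ℕ} (δ : Permutation′ n) {a b : Fin n} (a<b : a F.< b)
         (δa<δb : δ ⟨$⟩ʳ a F.< δ ⟨$⟩ʳ b)
         (gap : ∀ {c} → a F.< c → c F.< b → δ ⟨$⟩ʳ a F.< δ ⟨$⟩ʳ c → ¬ δ ⟨$⟩ʳ c F.< δ ⟨$⟩ʳ b) where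

  open Transposition a b

  private
    below-a : ∀ {c} → a F.< c → c F.< b → δ ⟨$⟩ʳ c F.< δ ⟨$⟩ʳ b → δ ⟨$⟩ʳ c F.< δ ⟨$⟩ʳ a
    below-a {c} a<c c<b δc<δb with FP.<-cmp (δ ⟨$⟩ʳ c) (δ ⟨$⟩ʳ a)
    ... | tri< δc<δa _ _ = δc<δa
    ... | tri≈ _ δc≡δa _ = ⊥-elim (FP.<⇒≢ a<c (sym (permutation-injective δ δc≡δa)))
    ... | tri> _ _ δa<δc = ⊥-elim (gap a<c c<b δa<δc δc<δb)

    above-b : ∀ {c} → a F.< c → c F.< b → δ ⟨$⟩ʳ a F.< δ ⟨$⟩ʳ c → δ ⟨$⟩ʳ b F.< δ ⟨$⟩ʳ c
    above-b {c} a<c c<b δa<δc with FP.<-cmp (δ ⟨$⟩ʳ b) (δ ⟨$⟩ʳ c)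
    ... | tri< δb<δc _ _ = δb<δc
    ... | tri≈ _ δb≡δc _ = ⊥-elim (FP.<⇒≢ c<b (sym (permutation-injective δ δb≡δc)))
    ... | tri> _ _ δc<δb = ⊥-elim (gap a<c c<b δa<δc δc<δb)

    descent-at : ∀ {i j} → toℕ j ≡ suc (toℕ i) → δ ⟨$⟩ʳ j F.< δ ⟨$⟩ʳ i → IsDescent δ (suc (toℕ i))
    descent-at {i} {j} j≡1+i δj<δi = i , j , refl , j≡1+i , δj<δi

  descent-transpose : ∀ {d} → IsDescent (transpose a b ∘ₚ δ) d →
                      IsDescent δ d ⊎ (d ≡ suc (toℕ a) × d ≡ toℕ b)
  descent-transpose (i , j , refl , j≡1+i , lt) = go (view i) (view j) j≡1+i lt
    where
    go : ∀ {i j} → View i → View j → toℕ j ≡ suc (toℕ i) → δ ⟨$⟩ʳ t j F.< δ ⟨$⟩ʳ t i →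
         IsDescent δ (suc (toℕ i)) ⊎ (suc (toℕ i) ≡ suc (toℕ a) × suc (toℕ i) ≡ toℕ b)
    go at-a at-a j≡1+i _ = ⊥-elim (NP.1+n≢n (sym j≡1+i))
    go at-a at-b j≡1+i _ = inj₂ (refl , sym j≡1+i)
    go {j = j} at-a (elsewhere j≢a j≢b) j≡1+i lt rewrite t-a | t-fix j≢a j≢b =
      inj₁ (descent-at j≡1+i (below-a a<j j<b lt))
      where
      a<j : a F.< j
      a<j = NP.≤-reflexive (sym j≡1+i)
      j<b : j F.< b
      j<b = FP.≤∧≢⇒< (subst (_≤ toℕ b) (sym j≡1+i) a<b) j≢b
    go at-b at-a j≡1+i _ = ⊥-elim (FP.<-asym a<b (NP.≤-reflexive (sym j≡1+i)))
    go at-b at-b j≡1+i _ = ⊥-elim (NP.1+n≢n (sym j≡1+i))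
    go at-b (elsewhere j≢a j≢b) j≡1+i lt rewrite t-b | t-fix j≢a j≢b =
      inj₁ (descent-at j≡1+i (FP.<-trans lt δa<δb))
    go (elsewhere i≢a i≢b) at-a j≡1+i lt rewrite t-a | t-fix i≢a i≢b =
      inj₁ (descent-at j≡1+i (FP.<-trans δa<δb lt))
    go {i = i} (elsewhere i≢a i≢b) at-b j≡1+i lt rewrite t-b | t-fix i≢a i≢b =
      inj₁ (descent-at j≡1+i (above-b a<i i<b lt))
      where
      i<b : i F.< b
      i<b = NP.≤-reflexive (sym j≡1+i)
      a<i : a F.< i
      a<i = FP.≤∧≢⇒< (s≤s⁻¹ (subst (suc (toℕ a) ≤_) j≡1+i a<b)) (i≢a ∘ sym)
    go (elsewhere i≢a i≢b) (elsewhere j≢a j≢b) j≡1+i lt rewrite t-fix i≢a i≢b | t-fix j≢a j≢b =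
      inj₁ (descent-at j≡1+i lt)

IsDescent-resp-≈ : ∀ {n} {x y : Permutation′ n} {d} → x ≈ y → IsDescent x d → IsDescent y d
IsDescent-resp-≈ x≈y (i , j , i≡ , j≡ , lt) = i , j , i≡ , j≡ , subst₂ F._<_ (x≈y j) (x≈y i) lt

⋖-new-descent : ∀ {n} (δ π : Permutation′ n) {m d} → δ ⋖[ m ] π →
                IsDescent π d → IsDescent δ d ⊎ d ≡ m
⋖-new-descent δ π {m} {d} (a , b , 1+a≤m , m<1+b , π≈ , cover) desc =
  map₂ d≡m (descent-transpose δ a<b (cover-increasing δ a<b cover′) (cover-gap δ a<b cover′)
                              (IsDescent-resp-≈ {x = π} {transpose a b ∘ₚ δ} π≈ desc))
  where
  m≤b : m ≤ toℕ b
  m≤b = s≤s⁻¹ m<1+b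
  a<b : a F.< b
  a<b = NP.≤-trans 1+a≤m m≤b
  cover′ : len (transpose a b ∘ₚ δ) ≡ suc (len δ)
  cover′ = trans (sym (len-cong {x = π} {transpose a b ∘ₚ δ} π≈)) cover
  d≡m : d ≡ suc (toℕ a) × d ≡ toℕ b → d ≡ m
  d≡m (refl , d≡b) = NP.≤-antisym 1+a≤m (subst (m ≤_) (sym d≡b) m≤b)

DescentsWithin : ∀ {n} → ℕ → ℕ → Permutation′ n → Set
DescentsWithin l k x = ∀ d → IsDescent x d → l ≤ d × d ≤ k

⋖-preserves-DescentsWithin : ∀ {n} (δ π : Permutation′ n) {l k m} → l ≤ m → m ≤ k →
                             δ ⋖[ m ] π → DescentsWithin l k δ → DescentsWithin l k π
⋖-preserves-DescentsWithin δ π l≤m m≤k δ⋖π within d desc with ⋖-new-descent δ π δ⋖π desc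
... | inj₁ δ-desc = within d δ-desc
... | inj₂ refl   = l≤m , m≤k

descent? : ∀ {n} (x : Permutation′ n) → Decidable (IsDescent x)
descent? x d = FP.any? λ i → FP.any? λ j →
  (suc (toℕ i) NP.≟ d) ×-dec (toℕ j NP.≟ d) ×-dec (x ⟨$⟩ʳ j F.<? x ⟨$⟩ʳ i)

descent<n : ∀ {n} (x : Permutation′ n) d → IsDescent x d → d < n
descent<n x d (_ , j , _ , refl , _) = FP.toℕ<n j

descent⇒¬IsId : ∀ {n} (x : Permutation′ n) {d} → IsDescent x d → ¬ IsId x
descent⇒¬IsId x (i , j , refl , j≡1+i , lt) x≈id =
  FP.<-asym (subst₂ F._<_ (x≈id j) (x≈id i) lt) (NP.≤-reflexive (sym j≡1+i))

extremes⇒DescentsWithin : ∀ {n} (δ : Permutation′ n) {l k} →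
  (¬ IsId δ → ∀ d₁ d₂ → IsFirstDescent δ d₁ → IsLastDescent δ d₂ → l ≤ d₁ × d₂ ≤ k) →
  DescentsWithin l k δ
extremes⇒DescentsWithin {n} δ hyp d desc
  with least (descent? δ) desc | greatest (descent? δ) n (descent<n δ) desc
... | d₁ , first | d₂ , last with hyp (descent⇒¬IsId δ desc) d₁ d₂ first last
...   | l≤d₁ , d₂≤k = NP.≤-trans l≤d₁ (proj₂ first d desc) , NP.≤-trans (proj₂ last d desc) d₂≤k

DescentsWithin⇒extremes : ∀ {n} (x : Permutation′ n) {l k d₁ d₂} → DescentsWithin l k x →
  IsFirstDescent x d₁ → IsLastDescent x d₂ → l ≤ d₁ × d₂ ≤ k
DescentsWithin⇒extremes x within (first , _) (last , _) =
  proj₁ (within _ first) , proj₂ (within _ last)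

lemma4p1 : (n : ℕ) (π σ δ ρ : Permutation′ n) (l k : ℕ) →
    1 ≤ l → l ≤ k →
    δ ⋖[ l ] π → ρ ⋖[ l ] σ → δ ⋖[ k ] ρ → π ⋖[ k ] σ →
    (¬ IsId δ → ∀ d₁ d₂ → IsFirstDescent δ d₁ → IsLastDescent δ d₂ → l ≤ d₁ × d₂ ≤ k) →
    (∀ d₁ d₂ → IsFirstDescent π d₁ → IsLastDescent π d₂ → d₂ ≤ k × l ≤ d₁)
    × (∀ d₁ d₂ → IsFirstDescent ρ d₁ → IsLastDescent ρ d₂ → l ≤ d₁ × d₂ ≤ k)
lemma4p1 n π σ δ ρ l k _ l≤k δ⋖π _ δ⋖ρ _ hyp =
    (λ _ _ first last → swap (DescentsWithin⇒extremes π π-within first last))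
  , (λ _ _ first last → DescentsWithin⇒extremes ρ ρ-within first last)
  where
  δ-within : DescentsWithin l k δ
  δ-within = extremes⇒DescentsWithin δ hyp
  π-within : DescentsWithin l k π
  π-within = ⋖-preserves-DescentsWithin δ π NP.≤-refl l≤k δ⋖π δ-within
  ρ-within : DescentsWithin l k ρ
  ρ-within = ⋖-preserves-DescentsWithin δ ρ l≤k NP.≤-refl δ⋖ρ δ-within
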